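{- Let $\mathcal{D}_h$ be a sound abstraction of $\mathcal{D}_l$ relative to a refinement mapping $m$. Then for any sequence of ground high-level actions $\vec\alpha$ and any high-level situation-suppressed formula $\phi$: if $\mathcal{D}_l\cup\mathcal{C}\cup\{\exists s.\,Do(m(\vec\alpha),S_0,s)\land m(\phi)[s]\}$ is satisfiable, then $\mathcal{D}_h\cup\{Executable(do(\vec\alpha,S_0))\land\phi[do(\vec\alpha,S_0)]\}$ is satisfiable. In particular, if $\mathcal{D}_l\cup\mathcal{C}\cup\{\exists s.\,Do(m(\vec\alpha),S_0,s)\}$ is satisfiable, then $\mathcal{D}_h\cup\{Executable(do(\vec\alpha,S_0))\}$ is satisfiable.
   Context: Situation calculus setting. Objects are a countably infinite set $\mathcal{N}$ of standard names (unique names and domain closure); no function symbols other than constants; no non-fluent predicates. Situations: $S_0$ and $do(a,s)$; $do([a_1,\dots,a_n],s)$ abbreviates $do(a_n,\dots,do(a_1,s)\dots)$, also written $do(\vec a,s)$. $Poss(a,s)$ means $a$ is executable in $s$; $Executable(s)$ means every action along the history from $S_0$ to $s$ was possible where performed. A basic action theory (BAT) over finitely many action types $\mathcal{A}$ and fluents $\mathcal{F}$ consists of initial-state axioms $\mathcal{D}_{S_0}$, precondition axioms $Poss(A(\vec x),s)\equiv\phi^{Poss}_A(\vec x,s)$, successor state axioms $F(\vec x,do(a,s))\equiv\phi^{ssa}_F(\vec x,a,s)$ (right-hand sides uniform in $s$), unique names/domain closure axioms for actions $\mathcal{D}_{ca}$ and for objects $\mathcal{D}_{coa}$, and foundational axioms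 $\Sigma$. A situation-suppressed formula omits situation arguments of fluents; $\phi[s]$ restores $s$. ConGolog programs $\delta::=\alpha\mid\varphi?\mid\delta_1;\delta_2\mid\delta_1|\delta_2\mid\pi x.\delta\mid\delta^*\mid\delta_1\|\delta_2$, $nil=True?$; $\mathcal{C}$ are the axioms: $Trans(\alpha,s,\delta',s')\equiv s'=do(\alpha,s)\land Poss(\alpha,s)\land\delta'=True?$; $Trans(\varphi?,s,\delta',s')\equiv False$; $Trans(\delta_1;\delta_2,s,\delta',s')\equiv\exists\delta_1'(Trans(\delta_1,s,\delta_1',s')\land\delta'=\delta_1';\delta_2)\lor(Final(\delta_1,s)\land Trans(\delta_2,s,\delta',s'))$; $Trans(\delta_1|\delta_2,\cdot)\equiv Trans(\delta_1,\cdot)\lor Trans(\delta_2,\cdot)$; $Trans(\pi x.\delta,s,\delta',s')\equiv\exists x.Trans(\delta,s,\delta',s')$; $Trans(\delta^*,s,\delta',s')\equiv\exists\delta''(Trans(\delta,s,\delta'',s')\land\delta'=\delta'';\delta^*)$; $Trans(\delta_1\|\delta_2,s,\delta',s')\equiv\exists\delta_1'(Trans(\delta_1,s,\delta_1',s')\land\delta'=\delta_1'\|\delta_2)\lor\exists\delta_2'(Trans(\delta_2,s,\delta_2',s')\land\delta'=\delta_1\|\delta_2')$; $Final(\alpha,s)\equiv False$; $Final(\varphi?,s)\equiv\varphi[s]$; $Final(\delta_1;\delta_2,s)\equiv Final(\delta_1,s)\land Final(\delta_2,s)$; $Final(\delta_1|\delta_2,s)\equiv Final(\delta_1,s)\lor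 Final(\delta_2,s)$; $Final(\pi x.\delta,s)\equiv\exists x.Final(\delta,s)$; $Final(\delta^*,s)\equiv True$; $Final(\delta_1\|\delta_2,s)\equiv Final(\delta_1,s)\land Final(\delta_2,s)$. $Do(\delta,s,s')\doteq\exists\delta'.Trans^*(\delta,s,\delta',s')\land Final(\delta',s')$, $Trans^*$ the reflexive transitive closure. $\mathcal{D}_h$ (high-level) and $\mathcal{D}_l$ (low-level) are BATs with action types $\mathcal{A}_h,\mathcal{A}_l$ and fluents $\mathcal{F}_h,\mathcal{F}_l$, sharing only $\mathcal{N}$. A refinement mapping $m$ maps each $A\in\mathcal{A}_h$ to a situation-determined ConGolog program $m(A(\vec x))$ over $\mathcal{D}_l$ with free variables $\vec x$, and each $F\in\mathcal{F}_h$ to a situation-suppressed low-level formula $m(F(\vec x))$; $m(\phi)$ substitutes $m(F(\vec x))$ for fluent atoms; $m(\alpha_1,\dots,\alpha_n)=m(\alpha_1);\dots;m(\alpha_n)$, $m(\epsilon)=nil$. For a model $M_h$ of $\mathcal{D}_h$ and a model $M_l$ of $\mathcal{D}_l\cup\mathcal{C}$: $s_h\simeq_m^{M_h,M_l}s_l$ iff for all $F\in\mathcal{F}_h$ and assignments $v$, $M_h,v[s/s_h]\models F(\vec x,s)$ iff $M_l,v[s/s_l]\models m(F(\vec x))[s]$. A relation $B$ between situation domains is an $m$-bisimulation if each $\langle s_h,s_l\rangle\in B$ satisfies: (1) $s_h\simeq_m^{M_h,M_l}s_l$; (2) for each $A\in\mathcal{A}_h$ and $v$, if some $s_h'$ has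 $M_h,v[s/s_h,s'/s_h']\models Poss(A(\vec x),s)\land s'=do(A(\vec x),s)$ then some $s_l'$ has $M_l,v[s/s_l,s'/s_l']\models Do(m(A(\vec x)),s,s')$ and $\langle s_h',s_l'\rangle\in B$; (3) conversely, if some $s_l'$ has $M_l,v[s/s_l,s'/s_l']\models Do(m(A(\vec x)),s,s')$ then some $s_h'$ has $M_h,v[s/s_h,s'/s_h']\models Poss(A(\vec x),s)\land s'=do(A(\vec x),s)$ and $\langle s_h',s_l'\rangle\in B$. $M_h\sim_m M_l$ iff some $m$-bisimulation contains $\langle S_0^{M_h},S_0^{M_l}\rangle$. $\mathcal{D}_h$ is a sound abstraction of $\mathcal{D}_l$ relative to $m$ iff for every model $M_l$ of $\mathcal{D}_l\cup\mathcal{C}$ there is a model $M_h$ of $\mathcal{D}_h$ with $M_h\sim_m M_l$. -}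

module Defs where

open import Data.Nat using (ℕ; zero; suc)
open import Data.Fin using (Fin; zero; suc)
open import Data.Vec using (Vec; []; _∷_; lookup; map)
open import Data.List using (List; []; _∷_)
open import Data.Product using (Σ; _×_; _,_)
open import Data.Sum using (_⊎_)
open import Data.Empty using (⊥)
open import Data.Unit using (⊤)
open import Relation.Binary.PropositionalEquality using (_≡_)

infix 2 _iff_
_iff_ : Set → Set → Set
A iff B = (A → B) × (B → A)

-- Signatures: finitely many action types and fluents, with arities.
-- Objects are the standard names ℕ.

record Sig : Set where
  field
    nA  : ℕ
    aAr : Fin nA → ℕ
    nF  : ℕ
    fAr : Fin nF → ℕ
open Sig public

Action : Sig → Set
Action L = Σ (Fin (nA L)) (λ A → Vec ℕ (aAr L A))

-- situations: S₀ = [], do(a,s) = a ∷ s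
Sit : Sig → Set
Sit L = List (Action L)

doSeq : {L : Sig} → List (Action L) → Sit L → Sit L
doSeq []       s = s
doSeq {L} (a ∷ as) s = doSeq {L} as (a ∷ s)

data Term (k : ℕ) : Set where
  var : Fin k → Term k
  nm  : ℕ → Term k

evalT : {k : ℕ} → Vec ℕ k → Term k → ℕ
evalT ρ (var i) = lookup ρ i
evalT ρ (nm n)  = n

data SFml (L : Sig) (k : ℕ) : Set where
  fl   : (F : Fin (nF L)) → Vec (Term k) (fAr L F) → SFml L k
  eq   : Term k → Term k → SFml L k
  tt ff : SFml L k
  neg  : SFml L k → SFml L k
  and or imp : SFml L k → SFml L k → SFml L k
  ex all : SFml L (suc k) → SFml L k

data ATerm (L : Sig) (k j : ℕ) : Set where
  avar : Fin j → ATerm L k j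
  act  : (A : Fin (nA L)) → Vec (Term k) (aAr L A) → ATerm L k j

data AFml (L : Sig) (k j : ℕ) : Set where
  fl   : (F : Fin (nF L)) → Vec (Term k) (fAr L F) → AFml L k j
  eq   : Term k → Term k → AFml L k j
  aeq  : ATerm L k j → ATerm L k j → AFml L k j
  tt ff : AFml L k j
  neg  : AFml L k j → AFml L k j
  and or imp : AFml L k j → AFml L k j → AFml L k j
  ex all : AFml L (suc k) j → AFml L k j
  exA allA : AFml L k (suc j) → AFml L k j

FluentVal : Sig → Set₁
FluentVal L = (F : Fin (nF L)) → Vec ℕ (fAr L F) → Set

sat : {L : Sig} {k : ℕ} → FluentVal L → Vec ℕ k → SFml L k → Set
sat I ρ (fl F ts)  = I F (map (evalT ρ) ts)
sat I ρ (eq t u)   = evalT ρ t ≡ evalT ρ u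
sat I ρ tt         = ⊤
sat I ρ ff         = ⊥
sat I ρ (neg φ)    = sat I ρ φ → ⊥
sat I ρ (and φ ψ)  = sat I ρ φ × sat I ρ ψ
sat I ρ (or φ ψ)   = sat I ρ φ ⊎ sat I ρ ψ
sat I ρ (imp φ ψ)  = sat I ρ φ → sat I ρ ψ
sat I ρ (ex φ)     = Σ ℕ (λ n → sat I (n ∷ ρ) φ)
sat I ρ (all φ)    = (n : ℕ) → sat I (n ∷ ρ) φ

evalA : {L : Sig} {k j : ℕ} → Vec ℕ k → Vec (Action L) j → ATerm L k j → Action L
evalA ρ α (avar i)   = lookup α i
evalA ρ α (act A ts) = A , map (evalT ρ) ts

asat : {L : Sig} {k j : ℕ} → FluentVal L → Vec ℕ k → Vec (Action L) j → AFml L k j → Set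
asat I ρ α (fl F ts)  = I F (map (evalT ρ) ts)
asat I ρ α (eq t u)   = evalT ρ t ≡ evalT ρ u
asat I ρ α (aeq t u)  = evalA ρ α t ≡ evalA ρ α u
asat I ρ α tt         = ⊤
asat I ρ α ff         = ⊥
asat I ρ α (neg φ)    = asat I ρ α φ → ⊥
asat I ρ α (and φ ψ)  = asat I ρ α φ × asat I ρ α ψ
asat I ρ α (or φ ψ)   = asat I ρ α φ ⊎ asat I ρ α ψ
asat I ρ α (imp φ ψ)  = asat I ρ α φ → asat I ρ α ψ
asat I ρ α (ex φ)     = Σ ℕ (λ n → asat I (n ∷ ρ) α φ)
asat I ρ α (all φ)    = (n : ℕ) → asat I (n ∷ ρ) α φ
asat {L} I ρ α (exA φ)    = Σ (Action L) (λ a → asat I ρ (a ∷ α) φ)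
asat {L} I ρ α (allA φ)   = (a : Action L) → asat I ρ (a ∷ α) φ

record BAT (L : Sig) : Set₁ where
  field
    DS0  : SFml L 0 → Set
    poss : (A : Fin (nA L)) → SFml L (aAr L A)
    ssa  : (F : Fin (nF L)) → AFml L (fAr L F) 1    -- F(x,do(a,s)) ≡ φ^ssa_F(x,a,s)
open BAT public

record Model {L : Sig} (D : BAT L) : Set₁ where
  field
    val    : Sit L → FluentVal L
    initOK : (φ : SFml L 0) → DS0 D φ → sat (val []) [] φ
    ssaOK  : (a : Action L) (s : Sit L) (F : Fin (nF L)) (xs : Vec ℕ (fAr L F)) →
             val (a ∷ s) F xs iff asat (val s) xs (a ∷ []) (ssa D F)
open Model public

Poss : {L : Sig} {D : BAT L} → Model D → Action L → Sit L → Set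
Poss {D = D} M (A , xs) s = sat (val M s) xs (poss D A)

Executable : {L : Sig} {D : BAT L} → Model D → Sit L → Set
Executable M []      = ⊤
Executable M (a ∷ s) = Executable M s × Poss M a s

data Prog (L : Sig) (k : ℕ) : Set where
  act  : (A : Fin (nA L)) → Vec (Term k) (aAr L A) → Prog L k
  test : SFml L k → Prog L k
  seq  : Prog L k → Prog L k → Prog L k
  choice : Prog L k → Prog L k → Prog L k
  pi   : Prog L (suc k) → Prog L k
  star : Prog L k → Prog L k
  conc : Prog L k → Prog L k → Prog L k

nil : {L : Sig} {k : ℕ} → Prog L k
nil = test tt

Subst : ℕ → ℕ → Set
Subst k k' = Fin k → Term k'

wkT : {k : ℕ} → Term k → Term (suc k)
wkT (var i) = var (suc i)
wkT (nm n)  = nm n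

substT : {k k' : ℕ} → Subst k k' → Term k → Term k'
substT σ (var i) = σ i
substT σ (nm n)  = nm n

lift : {k k' : ℕ} → Subst k k' → Subst (suc k) (suc k')
lift σ zero    = var zero
lift σ (suc i) = wkT (σ i)

substTs : {k k' n : ℕ} → Subst k k' → Vec (Term k) n → Vec (Term k') n
substTs σ []       = []
substTs σ (t ∷ ts) = substT σ t ∷ substTs σ ts

substS : {L : Sig} {k k' : ℕ} → Subst k k' → SFml L k → SFml L k'
substS σ (fl F ts) = fl F (substTs σ ts)
substS σ (eq t u)  = eq (substT σ t) (substT σ u)
substS σ tt        = tt
substS σ ff        = ff
substS σ (neg φ)   = neg (substS σ φ)
substS σ (and φ ψ) = and (substS σ φ) (substS σ ψ)
substS σ (or φ ψ)  = or (substS σ φ) (substS σ ψ)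
substS σ (imp φ ψ) = imp (substS σ φ) (substS σ ψ)
substS σ (ex φ)    = ex (substS (lift σ) φ)
substS σ (all φ)   = all (substS (lift σ) φ)

substP : {L : Sig} {k k' : ℕ} → Subst k k' → Prog L k → Prog L k'
substP σ (act A ts)     = act A (substTs σ ts)
substP σ (test φ)       = test (substS σ φ)
substP σ (seq d e)      = seq (substP σ d) (substP σ e)
substP σ (choice d e)   = choice (substP σ d) (substP σ e)
substP σ (pi d)         = pi (substP (lift σ) d)
substP σ (star d)       = star (substP σ d)
substP σ (conc d e)     = conc (substP σ d) (substP σ e)

inst : {L : Sig} {k : ℕ} → Prog L (suc k) → ℕ → Prog L k
inst d n = substP σ d
  where
    σ : Subst _ _
    σ zero    = nm n
    σ (suc i) = var i

close : {L : Sig} {k : ℕ} → Prog L k → Vec ℕ k → Prog L 0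
close d xs = substP (λ i → nm (lookup xs i)) d

-- Transition semantics (the axioms 𝒞) in a model of a BAT

module Semantics {L : Sig} {D : BAT L} (M : Model D) where

  data Final : Prog L 0 → Sit L → Set where
    f-test  : {φ : SFml L 0} {s : Sit L} → sat (val M s) [] φ → Final (test φ) s
    f-seq   : {d e : Prog L 0} {s : Sit L} → Final d s → Final e s → Final (seq d e) s
    f-or₁   : {d e : Prog L 0} {s : Sit L} → Final d s → Final (choice d e) s
    f-or₂   : {d e : Prog L 0} {s : Sit L} → Final e s → Final (choice d e) s
    f-pi    : {d : Prog L 1} {s : Sit L} (n : ℕ) → Final (inst d n) s → Final (pi d) s
    f-star  : {d : Prog L 0} {s : Sit L} → Final (star d) s
    f-conc  : {d e : Prog L 0} {s : Sit L} → Final d s → Final e s → Final (conc d e) s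

  data Trans : Prog L 0 → Sit L → Prog L 0 → Sit L → Set where
    t-act   : {A : Fin (nA L)} {ts : Vec (Term 0) (aAr L A)} {s : Sit L} →
              Poss M (A , map (evalT []) ts) s →
              Trans (act A ts) s nil ((A , map (evalT []) ts) ∷ s)
    t-seq₁  : {d d' e : Prog L 0} {s s' : Sit L} →
              Trans d s d' s' → Trans (seq d e) s (seq d' e) s'
    t-seq₂  : {d e e' : Prog L 0} {s s' : Sit L} →
              Final d s → Trans e s e' s' → Trans (seq d e) s e' s'
    t-or₁   : {d e d' : Prog L 0} {s s' : Sit L} →
              Trans d s d' s' → Trans (choice d e) s d' s'
    t-or₂   : {d e e' : Prog L 0} {s s' : Sit L} →
              Trans e s e' s' → Trans (choice d e) s e' s'
    t-pi    : {d : Prog L 1} {d' : Prog L 0} {s s' : Sit L} (n : ℕ) →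
              Trans (inst d n) s d' s' → Trans (pi d) s d' s'
    t-star  : {d d' : Prog L 0} {s s' : Sit L} →
              Trans d s d' s' → Trans (star d) s (seq d' (star d)) s'
    t-conc₁ : {d d' e : Prog L 0} {s s' : Sit L} →
              Trans d s d' s' → Trans (conc d e) s (conc d' e) s'
    t-conc₂ : {d e e' : Prog L 0} {s s' : Sit L} →
              Trans e s e' s' → Trans (conc d e) s (conc d e') s'

  data Trans* : Prog L 0 → Sit L → Prog L 0 → Sit L → Set where
    refl* : {d : Prog L 0} {s : Sit L} → Trans* d s d s
    step* : {d d' d'' : Prog L 0} {s s' s'' : Sit L} →
            Trans d s d' s' → Trans* d' s' d'' s'' → Trans* d s d'' s''

  Do : Prog L 0 → Sit L → Sit L → Set
  Do d s s' = Σ (Prog L 0) (λ d' → Trans* d s d' s' × Final d' s')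

  SituationDetermined : Prog L 0 → Sit L → Set
  SituationDetermined d s = {d' d'' : Prog L 0} {s' : Sit L} →
    Trans* d s d' s' → Trans* d s d'' s' → d' ≡ d''

record Mapping (Lh Ll : Sig) : Set where
  field
    mAct : (A : Fin (nA Lh)) → Prog Ll (aAr Lh A)
    mFl  : (F : Fin (nF Lh)) → SFml Ll (fAr Lh F)
open Mapping public

SitDetMapping : {Lh Ll : Sig} → BAT Ll → Mapping Lh Ll → Set₁
SitDetMapping {Lh} {Ll} Dl m =
  (M : Model Dl) (A : Fin (nA Lh)) (xs : Vec ℕ (aAr Lh A)) (s : Sit Ll) →
  Semantics.SituationDetermined M (close (mAct m A) xs) s

mapF : {Lh Ll : Sig} {k : ℕ} → Mapping Lh Ll → SFml Lh k → SFml Ll k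
mapF m (fl F ts) = substS (λ i → lookup ts i) (mFl m F)
mapF m (eq t u)  = eq t u
mapF m tt        = tt
mapF m ff        = ff
mapF m (neg φ)   = neg (mapF m φ)
mapF m (and φ ψ) = and (mapF m φ) (mapF m ψ)
mapF m (or φ ψ)  = or (mapF m φ) (mapF m ψ)
mapF m (imp φ ψ) = imp (mapF m φ) (mapF m ψ)
mapF m (ex φ)    = ex (mapF m φ)
mapF m (all φ)   = all (mapF m φ)

mapA : {Lh Ll : Sig} → Mapping Lh Ll → Action Lh → Prog Ll 0
mapA m (A , xs) = close (mAct m A) xs

mapSeq : {Lh Ll : Sig} → Mapping Lh Ll → List (Action Lh) → Prog Ll 0
mapSeq m []           = nil
mapSeq m (a ∷ [])     = mapA m a
mapSeq m (a ∷ b ∷ as) = seq (mapA m a) (mapSeq m (b ∷ as))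

module _ {Lh Ll : Sig} {Dh : BAT Lh} {Dl : BAT Ll} (m : Mapping Lh Ll)
         (Mh : Model Dh) (Ml : Model Dl) where
  open Semantics Ml

  mIsomorphic : Sit Lh → Sit Ll → Set
  mIsomorphic sh sl = (F : Fin (nF Lh)) (xs : Vec ℕ (fAr Lh F)) →
    val Mh sh F xs iff sat (val Ml sl) xs (mFl m F)

  IsBisimulation : (Sit Lh → Sit Ll → Set) → Set
  IsBisimulation B = (sh : Sit Lh) (sl : Sit Ll) → B sh sl →
      mIsomorphic sh sl
    × ((A : Fin (nA Lh)) (xs : Vec ℕ (aAr Lh A)) →
         Poss Mh (A , xs) sh →
         Σ (Sit Ll) (λ sl' → Do (close (mAct m A) xs) sl sl' × B ((A , xs) ∷ sh) sl'))
    × ((A : Fin (nA Lh)) (xs : Vec ℕ (aAr Lh A)) (sl' : Sit Ll) →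
         Do (close (mAct m A) xs) sl sl' →
         Poss Mh (A , xs) sh × B ((A , xs) ∷ sh) sl')

  Bisimilar : Set₁
  Bisimilar = Σ (Sit Lh → Sit Ll → Set) (λ B → IsBisimulation B × B [] [])

SoundAbstraction : {Lh Ll : Sig} → BAT Lh → BAT Ll → Mapping Lh Ll → Set₁
SoundAbstraction Dh Dl m = (Ml : Model Dl) → Σ (Model Dh) (λ Mh → Bisimilar m Mh Ml)

LowSat : {Lh Ll : Sig} → BAT Ll → Mapping Lh Ll → List (Action Lh) → SFml Lh 0 → Set₁
LowSat {Ll = Ll} Dl m αs φ = Σ (Model Dl) (λ Ml →
  Σ (Sit Ll) (λ s → Semantics.Do Ml (mapSeq m αs) [] s × sat (val Ml s) [] (mapF m φ)))

HighSat : {Lh : Sig} → BAT Lh → List (Action Lh) → SFml Lh 0 → Set₁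
HighSat {Lh} Dh αs φ = Σ (Model Dh) (λ Mh →
  Executable Mh (doSeq {Lh} αs []) × sat (val Mh (doSeq {Lh} αs [])) [] φ)

LowSatDo : {Lh Ll : Sig} → BAT Ll → Mapping Lh Ll → List (Action Lh) → Set₁
LowSatDo {Ll = Ll} Dl m αs = Σ (Model Dl) (λ Ml → Σ (Sit Ll) (λ s → Semantics.Do Ml (mapSeq m αs) [] s))

HighSatExec : {Lh : Sig} → BAT Lh → List (Action Lh) → Set₁
HighSatExec {Lh} Dh αs = Σ (Model Dh) (λ Mh → Executable Mh (doSeq {Lh} αs []))

-- A bisimulation relates S₀ of some high-level model to S₀ of the given
-- low-level one.  Splitting a run of m(α₁);…;m(αₙ) into runs of the m(αᵢ)
-- and applying the back-and-forth clause (3) of the bisimulation to each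
-- piece shows that every αᵢ is possible in turn, and that do(α⃗,S₀) is
-- related to the end situation; the m-isomorphism there transfers m(φ) back
-- to φ.
module Submission where

open import Defs
open import Data.List using (List; []; _∷_)
open import Data.Product using (_×_; Σ; _,_; proj₁; proj₂)
open import Data.Sum using (_⊎_; inj₁; inj₂)
open import Data.Empty using (⊥)
open import Data.Unit using (tt)
open import Data.Nat using (ℕ)
open import Data.Fin using (zero; suc)
open import Data.Vec using (Vec; []; _∷_; lookup; map)
open import Data.Vec.Properties using (lookup-map)
open import Relation.Binary.PropositionalEquality using (_≡_; refl; sym; trans; cong₂)

private variable
  A B C A' B' : Set

iff-refl : A iff A
iff-refl = (λ x → x) , (λ x → x)

iff-sym : A iff B → B iff A
iff-sym (f , g) = g , f

iff-trans : A iff B → B iff C → A iff C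
iff-trans (f , g) (f' , g') = (λ x → f' (f x)) , (λ x → g (g' x))

¬-iff : A iff B → (A → ⊥) iff (B → ⊥)
¬-iff (f , g) = (λ n x → n (g x)) , (λ n x → n (f x))

×-iff : A iff B → A' iff B' → (A × A') iff (B × B')
×-iff (f , g) (f' , g') = (λ { (a , b) → f a , f' b }) , (λ { (a , b) → g a , g' b })

⊎-iff : A iff B → A' iff B' → (A ⊎ A') iff (B ⊎ B')
⊎-iff (f , g) (f' , g') =
  (λ { (inj₁ a) → inj₁ (f a) ; (inj₂ b) → inj₂ (f' b) }) ,
  (λ { (inj₁ a) → inj₁ (g a) ; (inj₂ b) → inj₂ (g' b) })

→-iff : A iff B → A' iff B' → (A → A') iff (B → B')
→-iff (f , g) (f' , g') = (λ k x → f' (k (g x))) , (λ k x → g' (k (f x)))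

module _ {I : Set} {P Q : I → Set} where

  Σ-iff : (∀ i → P i iff Q i) → Σ I P iff Σ I Q
  Σ-iff h = (λ { (i , p) → i , proj₁ (h i) p }) , (λ { (i , q) → i , proj₂ (h i) q })

  Π-iff : (∀ i → P i iff Q i) → ((i : I) → P i) iff ((i : I) → Q i)
  Π-iff h = (λ p i → proj₁ (h i) (p i)) , (λ q i → proj₂ (h i) (q i))

≡⇒iff : {I : Set} (P : I → Set) {i j : I} → i ≡ j → P i iff P j
≡⇒iff P refl = iff-refl

≡-iff : {a a' b b' : ℕ} → a ≡ a' → b ≡ b' → (a ≡ b) iff (a' ≡ b')
≡-iff refl refl = iff-refl

Instantiates : {k k' : ℕ} → Subst k k' → Vec ℕ k' → Vec ℕ k → Set
Instantiates σ ρ ρ' = ∀ i → evalT ρ (σ i) ≡ lookup ρ' i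

evalT-wkT : {k : ℕ} (n : ℕ) (ρ : Vec ℕ k) (t : Term k) → evalT (n ∷ ρ) (wkT t) ≡ evalT ρ t
evalT-wkT n ρ (var i) = refl
evalT-wkT n ρ (nm x)  = refl

module _ {k k' : ℕ} {σ : Subst k k'} {ρ : Vec ℕ k'} {ρ' : Vec ℕ k} (σρ : Instantiates σ ρ ρ') where

  evalT-substT : (t : Term k) → evalT ρ (substT σ t) ≡ evalT ρ' t
  evalT-substT (var i) = σρ i
  evalT-substT (nm x)  = refl

  map-evalT-substTs : {n : ℕ} (ts : Vec (Term k) n) → map (evalT ρ) (substTs σ ts) ≡ map (evalT ρ') ts
  map-evalT-substTs []       = refl
  map-evalT-substTs (t ∷ ts) = cong₂ _∷_ (evalT-substT t) (map-evalT-substTs ts)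

  lift-instantiates : (n : ℕ) → Instantiates (lift σ) (n ∷ ρ) (n ∷ ρ')
  lift-instantiates n zero    = refl
  lift-instantiates n (suc i) = trans (evalT-wkT n ρ (σ i)) (σρ i)

sat-substS : {L : Sig} {k k' : ℕ} (I : FluentVal L) {σ : Subst k k'} {ρ : Vec ℕ k'} {ρ' : Vec ℕ k} →
  Instantiates σ ρ ρ' → (ψ : SFml L k) → sat I ρ (substS σ ψ) iff sat I ρ' ψ
sat-substS I σρ (fl F ts) = ≡⇒iff (I F) (map-evalT-substTs σρ ts)
sat-substS I σρ (eq t u)  = ≡-iff (evalT-substT σρ t) (evalT-substT σρ u)
sat-substS I σρ tt        = iff-refl
sat-substS I σρ ff        = iff-refl
sat-substS I σρ (neg ψ)   = ¬-iff (sat-substS I σρ ψ)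
sat-substS I σρ (and φ ψ) = ×-iff (sat-substS I σρ φ) (sat-substS I σρ ψ)
sat-substS I σρ (or φ ψ)  = ⊎-iff (sat-substS I σρ φ) (sat-substS I σρ ψ)
sat-substS I σρ (imp φ ψ) = →-iff (sat-substS I σρ φ) (sat-substS I σρ ψ)
sat-substS I σρ (ex ψ)    = Σ-iff λ n → sat-substS I (lift-instantiates σρ n) ψ
sat-substS I σρ (all ψ)   = Π-iff λ n → sat-substS I (lift-instantiates σρ n) ψ

module _ {L : Sig} {D : BAT L} (M : Model D) where
  open Semantics M

  Final⇒Do : {d : Prog L 0} {s : Sit L} → Final d s → Do d s s
  Final⇒Do fin = _ , refl* , fin

  Do-seq-split : {d e : Prog L 0} {s s'' : Sit L} → Do (seq d e) s s'' →
    Σ (Sit L) (λ s' → Do d s s' × Do e s' s'')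
  Do-seq-split (_ , refl* , f-seq fd fe) = _ , Final⇒Do fd , Final⇒Do fe
  Do-seq-split (_ , step* (t-seq₁ t) rest , fin) with Do-seq-split (_ , rest , fin)
  ... | s' , (d' , r , f) , de = s' , (d' , step* t r , f) , de
  Do-seq-split (_ , step* (t-seq₂ fd t) rest , fin) = _ , Final⇒Do fd , (_ , step* t rest , fin)

  Do-nil⇒≡ : {s s' : Sit L} → Do nil s s' → s ≡ s'
  Do-nil⇒≡ (_ , refl* , _)      = refl
  Do-nil⇒≡ (_ , step* () _ , _)

  module _ {Lh : Sig} (m : Mapping Lh L) where

    Do-mapSeq-∷ : (a : Action Lh) (αs : List (Action Lh)) {s s'' : Sit L} →
      Do (mapSeq m (a ∷ αs)) s s'' →
      Σ (Sit L) (λ s' → Do (mapA m a) s s' × Do (mapSeq m αs) s' s'')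
    Do-mapSeq-∷ a []       run = _ , run , Final⇒Do (f-test tt)
    Do-mapSeq-∷ a (b ∷ αs) run = Do-seq-split run

module _ {Lh Ll : Sig} {Dh : BAT Lh} {Dl : BAT Ll} (m : Mapping Lh Ll)
         (Mh : Model Dh) (Ml : Model Dl) where
  open Semantics Ml

  sat-mapF : {sh : Sit Lh} {sl : Sit Ll} → mIsomorphic m Mh Ml sh sl →
    {k : ℕ} (ρ : Vec ℕ k) (φ : SFml Lh k) → sat (val Mh sh) ρ φ iff sat (val Ml sl) ρ (mapF m φ)
  sat-mapF {sl = sl} iso ρ (fl F ts) =
    iff-trans (iso F (map (evalT ρ) ts))
              (iff-sym (sat-substS (val Ml sl) (λ i → sym (lookup-map i (evalT ρ) ts)) (mFl m F)))
  sat-mapF iso ρ (eq t u)  = iff-refl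
  sat-mapF iso ρ tt        = iff-refl
  sat-mapF iso ρ ff        = iff-refl
  sat-mapF iso ρ (neg ψ)   = ¬-iff (sat-mapF iso ρ ψ)
  sat-mapF iso ρ (and φ ψ) = ×-iff (sat-mapF iso ρ φ) (sat-mapF iso ρ ψ)
  sat-mapF iso ρ (or φ ψ)  = ⊎-iff (sat-mapF iso ρ φ) (sat-mapF iso ρ ψ)
  sat-mapF iso ρ (imp φ ψ) = →-iff (sat-mapF iso ρ φ) (sat-mapF iso ρ ψ)
  sat-mapF iso ρ (ex ψ)    = Σ-iff λ n → sat-mapF iso (n ∷ ρ) ψ
  sat-mapF iso ρ (all ψ)   = Π-iff λ n → sat-mapF iso (n ∷ ρ) ψ

  module _ {B : Sit Lh → Sit Ll → Set} (isB : IsBisimulation m Mh Ml B) where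

    Do-mapSeq⇒Executable : (αs : List (Action Lh)) {sh : Sit Lh} {sl s : Sit Ll} →
      B sh sl → Executable Mh sh → Do (mapSeq m αs) sl s →
      Executable Mh (doSeq {Lh} αs sh) × B (doSeq {Lh} αs sh) s
    Do-mapSeq⇒Executable [] b exe run with Do-nil⇒≡ Ml run
    ... | refl = exe , b
    Do-mapSeq⇒Executable (a ∷ αs) {sh} {sl} b exe run
      with Do-mapSeq-∷ Ml m a αs run
    ... | s' , runA , runRest
      with proj₂ (proj₂ (isB sh sl b)) (proj₁ a) (proj₂ a) s' runA
    ... | possA , b' = Do-mapSeq⇒Executable αs b' (exe , possA) runRest

sound-abstraction-Do : {Lh Ll : Sig} {Dh : BAT Lh} {Dl : BAT Ll} {m : Mapping Lh Ll} →
  SoundAbstraction Dh Dl m → (Ml : Model Dl) (αs : List (Action Lh)) {s : Sit Ll} →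
  Semantics.Do Ml (mapSeq m αs) [] s →
  Σ (Model Dh) (λ Mh → Executable Mh (doSeq {Lh} αs []) × mIsomorphic m Mh Ml (doSeq {Lh} αs []) s)
sound-abstraction-Do {m = m} sa Ml αs run with sa Ml
... | Mh , B , isB , b₀ with Do-mapSeq⇒Executable m Mh Ml isB αs b₀ tt run
... | exe , b = Mh , exe , proj₁ (isB _ _ b)

corollary1 : {Lh Ll : Sig} (Dh : BAT Lh) (Dl : BAT Ll) (m : Mapping Lh Ll) →
    SitDetMapping Dl m →
    SoundAbstraction Dh Dl m →
    ((αs : List (Action Lh)) (φ : SFml Lh 0) → LowSat Dl m αs φ → HighSat Dh αs φ)
    × ((αs : List (Action Lh)) → LowSatDo Dl m αs → HighSatExec Dh αs)
corollary1 {Lh} Dh Dl m _ sa = with-formula , executable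
  where
  with-formula : (αs : List (Action Lh)) (φ : SFml Lh 0) → LowSat Dl m αs φ → HighSat Dh αs φ
  with-formula αs φ (Ml , s , run , mφ) with sound-abstraction-Do sa Ml αs run
  ... | Mh , exe , iso = Mh , exe , proj₂ (sat-mapF m Mh Ml iso [] φ) mφ

  executable : (αs : List (Action Lh)) → LowSatDo Dl m αs → HighSatExec Dh αs
  executable αs (Ml , s , run) with sound-abstraction-Do sa Ml αs run
  ... | Mh , exe , _ = Mh , exe
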